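{- Let $\mathcal{L}$ be a finite FOLDS signature. If $\mathcal{S}$ is a derivable judgment of the logical type theory $LTT_{\mathcal{L}}$, then its interpretation $[\![\mathcal{S}]\!]$ is a derivable judgment of MLTT.
   Context: A FOLDS signature is an inverse category $\mathcal{L}$ (skeletal, no non-identity endomorphisms, each object the domain of finitely many arrows) with a proper order: a partial order $<$ on objects with $K_f<K$ for every non-identity $f\colon K\to K_f$, and a partial order on arrows with $f<g$ whenever $\operatorname{cod}f<\operatorname{cod}g$; $K/\!/\mathcal{L}$ is the set of non-identity arrows with domain $K$, $K_f$ the codomain of $f$, and indexed tuples are listed in increasing order. Finite means finitely many objects and arrows. Syntax $LTT_{\mathcal{L}}$: sort expressions $A(x_f)_{f\in A/\!/\mathcal{L}}$; contexts are lists $x_1:K_1,\dots,x_n:K_n$; formulas are built from $\bot,\top$ by $\wedge,\vee,\to$ and $\forall x:K$, $\exists x:K$. Judgments $\Gamma\ \mathbf{ok}$, $\Gamma\vdash K\ \mathbf{Sort}$, $\Gamma\vdash x:K$, $\Gamma\vdash\phi\ \mathbf{formula}$ are generated by: $\varnothing\ \mathbf{ok}$; context extension by a fresh variable of a well-formed sort; weakening for sorts and formulas; $\Gamma,x:K,\Delta\ \mathbf{ok}\Rightarrow\Gamma,x:K,\Delta\vdash x:K$; for each object $K$, from $\Gamma\vdash x_f:K_f(x_{pf})_{p\in K_f/\!/\mathcal{L}}$ for all $f\in K/\!/\mathcal{L}$ (just $\Gamma\ \mathbf{ok}$ if none) infer $\Gamma\vdash K(x_f)_f\ \mathbf{Sort}$;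 $\bot,\top$ are formulas in any ok context; binary connectives of formulas in $\Gamma$ are formulas in $\Gamma$; from $\Gamma\vdash K\ \mathbf{Sort}$... more precisely from $\Gamma\ \mathbf{ok}$ and $\Gamma,x:K\vdash\phi\ \mathbf{formula}$ infer $\Gamma\vdash Qx:K.\phi\ \mathbf{formula}$ for $Q\in\{\forall,\exists\}$. MLTT: intensional Martin-Löf type theory with $\Pi,\Sigma,\mathbf{1}$ (term $*$), $+$, $\mathbf{0}$ and a universe à la Tarski $\mathcal{U}$ with decoding $\mathrm{El}$. $\mathrm{Struc}(\mathcal{L}):=\Sigma(K_1:T_{K_1})\cdots(K_m:T_{K_m})$ over the objects $K_1<\dots<K_m$, where (naming type-theoretic variables by arrows of $\mathcal{L}$, equal composites naming the same variable) $T_K:=\Pi(f:\mathrm{El}(\mathrm{app}[K_f(pf)_{p\in K_f/\!/\mathcal{L}}]))_{f\in K/\!/\mathcal{L}}\ \mathcal{U}$, with $\mathrm{app}[K'(q_1,\dots,q_k)]$ the iterated application of $K'$ to $q_1,\dots,q_k$ ($\mathrm{app}(*,K')$ if $k=0$), and $T_K:=\mathbf{1}\to\mathcal{U}$ if $K/\!/\mathcal{L}=\varnothing$. Write $K^{\mathcal{M}}$ for the $K$-th projection of a variable $\mathcal{M}:\mathrm{Struc}(\mathcal{L})$. The interpretation $[\![-]\!]$: $[\![\varnothing]\!]:=(\mathcal{M}:\mathrm{Struc}(\mathcal{L}))$, $[\![\Gamma,x:K]\!]:=[\![\Gamma]\!],x:[\![K]\!]$; $[\![K(\mathbf{x})]\!]:=\mathrm{El}(\mathrm{app}[K^{\mathcal{M}}(\mathbf{x})])$;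 $[\![\bot]\!]=\mathbf{0}$, $[\![\top]\!]=\mathbf{1}$, $[\![\phi\wedge\psi]\!]=[\![\phi]\!]\times[\![\psi]\!]$, $[\![\phi\vee\psi]\!]=[\![\phi]\!]+[\![\psi]\!]$, $[\![\phi\to\psi]\!]=[\![\phi]\!]\to[\![\psi]\!]$, $[\![\exists x:K.\phi]\!]=\Sigma(x:[\![K]\!])[\![\phi]\!]$, $[\![\forall x:K.\phi]\!]=\Pi(x:[\![K]\!])[\![\phi]\!]$; variables are mapped to themselves; judgments: $\Gamma\ \mathbf{ok}\mapsto[\![\Gamma]\!]\ \mathbf{ok}$, $\Gamma\vdash K\ \mathbf{Sort}\mapsto[\![\Gamma]\!]\vdash[\![K]\!]\ \mathbf{Type}$, $\Gamma\vdash x:K\mapsto[\![\Gamma]\!]\vdash x:[\![K]\!]$, $\Gamma\vdash\phi\ \mathbf{formula}\mapsto[\![\Gamma]\!]\vdash[\![\phi]\!]\ \mathbf{Type}$. -}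

module Defs where

open import Data.Nat using (ℕ; zero; suc; _+_; _∸_)
open import Data.Fin as Fin using (Fin; toℕ)
open import Data.Vec as Vec using (Vec; lookup; tabulate)
open import Data.List as List using (List; []; _∷_; map; allFin)
open import Data.Product using (Σ; _,_; _×_)
open import Data.Unit using (⊤)
open import Relation.Nullary using (¬_)
open import Relation.Binary.PropositionalEquality using (_≡_; _≢_; subst; sym)
open import Relation.Binary.Structures using (IsStrictPartialOrder)
open import Data.Nat using (_≟_)
open import Relation.Nullary using (yes; no)

-- Objects are  Fin nObj ; the non-identity arrows with domain K
-- (the set K//L) are  Fin (nArr K) , with codomain  cod K f  (= K_f).
-- Identities are implicit.  comp K f p  is the composite  p∘f  (written
-- pf in the paper), again a non-identity arrow out of K.
-- The listing order of objects / of each K//L ("indexed tuples are listed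
-- in increasing order") is the order of Fin, which is required to be a
-- linear extension of the proper order.

record FOLDS : Set₁ where
  field
    nObj  : ℕ
    nArr  : Fin nObj → ℕ
    cod   : (K : Fin nObj) → Fin (nArr K) → Fin nObj
    comp  : (K : Fin nObj) (f : Fin (nArr K)) → Fin (nArr (cod K f)) → Fin (nArr K)
    cod-comp : ∀ K f p → cod K (comp K f p) ≡ cod (cod K f) p
    assoc : ∀ K f p (q : Fin (nArr (cod (cod K f) p))) →
            comp K (comp K f p) (subst (λ c → Fin (nArr c)) (sym (cod-comp K f p)) q)
              ≡ comp K f (comp (cod K f) p q)
    _<ₒ_  : Fin nObj → Fin nObj → Set
    <ₒ-spo : IsStrictPartialOrder _≡_ _<ₒ_
    cod-<ₒ : ∀ K f → cod K f <ₒ K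
    _<ₐ_  : Σ (Fin nObj) (λ K → Fin (nArr K)) → Σ (Fin nObj) (λ K → Fin (nArr K)) → Set
    <ₐ-spo : IsStrictPartialOrder _≡_ _<ₐ_
    <ₐ-cod : ∀ K f K' g → cod K f <ₒ cod K' g → (K , f) <ₐ (K' , g)
    <ₒ-listing : ∀ {K K'} → K <ₒ K' → K Fin.< K'
    <ₐ-listing : ∀ K f g → (K , f) <ₐ (K , g) → f Fin.< g

-- MLTT (raw syntax with de Bruijn indices; one syntactic class)

data Tm : Set where
  var   : ℕ → Tm
  Pi Sg : Tm → Tm → Tm           -- second argument binds one variable
  Sum   : Tm → Tm → Tm
  One Zero U : Tm
  El    : Tm → Tm
  lam   : Tm → Tm                -- binds one variable
  app   : Tm → Tm → Tm
  pair  : Tm → Tm → Tm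
  fst snd : Tm → Tm
  star  : Tm
  inl inr : Tm → Tm
  case  : Tm → Tm → Tm → Tm → Tm -- case C c d e : C, c, d bind one variable
  abort : Tm → Tm → Tm           -- abort C e : C binds one variable
  ind1  : Tm → Tm → Tm → Tm      -- ind1 C c e : C binds one variable
  piᶜ sgᶜ : Tm → Tm → Tm         -- codes in U; second argument binds
  sumᶜ  : Tm → Tm → Tm
  oneᶜ zeroᶜ : Tm

liftR : (ℕ → ℕ) → ℕ → ℕ
liftR ρ zero = zero
liftR ρ (suc n) = suc (ρ n)

ren : (ℕ → ℕ) → Tm → Tm
ren ρ (var n) = var (ρ n)
ren ρ (Pi A B) = Pi (ren ρ A) (ren (liftR ρ) B)
ren ρ (Sg A B) = Sg (ren ρ A) (ren (liftR ρ) B)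
ren ρ (Sum A B) = Sum (ren ρ A) (ren ρ B)
ren ρ One = One
ren ρ Zero = Zero
ren ρ U = U
ren ρ (El a) = El (ren ρ a)
ren ρ (lam b) = lam (ren (liftR ρ) b)
ren ρ (app f a) = app (ren ρ f) (ren ρ a)
ren ρ (pair a b) = pair (ren ρ a) (ren ρ b)
ren ρ (fst p) = fst (ren ρ p)
ren ρ (snd p) = snd (ren ρ p)
ren ρ star = star
ren ρ (inl a) = inl (ren ρ a)
ren ρ (inr a) = inr (ren ρ a)
ren ρ (case C c d e) = case (ren (liftR ρ) C) (ren (liftR ρ) c) (ren (liftR ρ) d) (ren ρ e)
ren ρ (abort C e) = abort (ren (liftR ρ) C) (ren ρ e)
ren ρ (ind1 C c e) = ind1 (ren (liftR ρ) C) (ren ρ c) (ren ρ e)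
ren ρ (piᶜ a b) = piᶜ (ren ρ a) (ren (liftR ρ) b)
ren ρ (sgᶜ a b) = sgᶜ (ren ρ a) (ren (liftR ρ) b)
ren ρ (sumᶜ a b) = sumᶜ (ren ρ a) (ren ρ b)
ren ρ oneᶜ = oneᶜ
ren ρ zeroᶜ = zeroᶜ

wk : Tm → Tm
wk = ren suc

liftS : (ℕ → Tm) → ℕ → Tm
liftS σ zero = var zero
liftS σ (suc n) = wk (σ n)

sub : (ℕ → Tm) → Tm → Tm
sub σ (var n) = σ n
sub σ (Pi A B) = Pi (sub σ A) (sub (liftS σ) B)
sub σ (Sg A B) = Sg (sub σ A) (sub (liftS σ) B)
sub σ (Sum A B) = Sum (sub σ A) (sub σ B)
sub σ One = One
sub σ Zero = Zero
sub σ U = U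
sub σ (El a) = El (sub σ a)
sub σ (lam b) = lam (sub (liftS σ) b)
sub σ (app f a) = app (sub σ f) (sub σ a)
sub σ (pair a b) = pair (sub σ a) (sub σ b)
sub σ (fst p) = fst (sub σ p)
sub σ (snd p) = snd (sub σ p)
sub σ star = star
sub σ (inl a) = inl (sub σ a)
sub σ (inr a) = inr (sub σ a)
sub σ (case C c d e) = case (sub (liftS σ) C) (sub (liftS σ) c) (sub (liftS σ) d) (sub σ e)
sub σ (abort C e) = abort (sub (liftS σ) C) (sub σ e)
sub σ (ind1 C c e) = ind1 (sub (liftS σ) C) (sub σ c) (sub σ e)
sub σ (piᶜ a b) = piᶜ (sub σ a) (sub (liftS σ) b)
sub σ (sgᶜ a b) = sgᶜ (sub σ a) (sub (liftS σ) b)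
sub σ (sumᶜ a b) = sumᶜ (sub σ a) (sub σ b)
sub σ oneᶜ = oneᶜ
sub σ zeroᶜ = zeroᶜ

_[_]₀ : Tm → Tm → Tm
B [ a ]₀ = sub σ B
  where σ : ℕ → Tm
        σ zero = a
        σ (suc n) = var n

_[_]↑ : Tm → Tm → Tm
C [ t ]↑ = sub σ C
  where σ : ℕ → Tm
        σ zero = t
        σ (suc n) = var (suc n)

-- contexts: the head of the list is the last (innermost) variable
MCtx : Set
MCtx = List Tm

data MJudgment : Set where
  okᴹ   : MCtx → MJudgment
  typeᴹ : MCtx → Tm → MJudgment
  termᴹ : MCtx → Tm → Tm → MJudgment            -- Γ ⊢ t : A
  tyEqᴹ : MCtx → Tm → Tm → MJudgment
  tmEqᴹ : MCtx → Tm → Tm → Tm → MJudgment       -- Γ ⊢ t ≡ u : A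

data MDer : MJudgment → Set where
  ctx-nil  : MDer (okᴹ [])
  ctx-cons : ∀ {Γ A} → MDer (typeᴹ Γ A) → MDer (okᴹ (A ∷ Γ))
  var-zero : ∀ {Γ A} → MDer (typeᴹ Γ A) → MDer (termᴹ (A ∷ Γ) (var 0) (wk A))
  var-suc  : ∀ {Γ A B n} → MDer (termᴹ Γ (var n) A) → MDer (typeᴹ Γ B) →
             MDer (termᴹ (B ∷ Γ) (var (suc n)) (wk A))
  conv     : ∀ {Γ t A B} → MDer (termᴹ Γ t A) → MDer (tyEqᴹ Γ A B) → MDer (termᴹ Γ t B)
  conv-eq  : ∀ {Γ t u A B} → MDer (tmEqᴹ Γ t u A) → MDer (tyEqᴹ Γ A B) → MDer (tmEqᴹ Γ t u B)
  Pi-form  : ∀ {Γ A B} → MDer (typeᴹ Γ A) → MDer (typeᴹ (A ∷ Γ) B) → MDer (typeᴹ Γ (Pi A B))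
  Pi-intro : ∀ {Γ A B b} → MDer (typeᴹ Γ A) → MDer (termᴹ (A ∷ Γ) b B) → MDer (termᴹ Γ (lam b) (Pi A B))
  Pi-elim  : ∀ {Γ A B f a} → MDer (termᴹ Γ f (Pi A B)) → MDer (termᴹ Γ a A) →
             MDer (termᴹ Γ (app f a) (B [ a ]₀))
  Pi-β     : ∀ {Γ A B b a} → MDer (termᴹ (A ∷ Γ) b B) → MDer (termᴹ Γ a A) →
             MDer (tmEqᴹ Γ (app (lam b) a) (b [ a ]₀) (B [ a ]₀))
  Pi-η     : ∀ {Γ A B f} → MDer (termᴹ Γ f (Pi A B)) →
             MDer (tmEqᴹ Γ f (lam (app (wk f) (var 0))) (Pi A B))
  Sg-form  : ∀ {Γ A B} → MDer (typeᴹ Γ A) → MDer (typeᴹ (A ∷ Γ) B) → MDer (typeᴹ Γ (Sg A B))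
  Sg-intro : ∀ {Γ A B a b} → MDer (typeᴹ (A ∷ Γ) B) → MDer (termᴹ Γ a A) →
             MDer (termᴹ Γ b (B [ a ]₀)) → MDer (termᴹ Γ (pair a b) (Sg A B))
  Sg-fst   : ∀ {Γ A B p} → MDer (termᴹ Γ p (Sg A B)) → MDer (termᴹ Γ (fst p) A)
  Sg-snd   : ∀ {Γ A B p} → MDer (termᴹ Γ p (Sg A B)) → MDer (termᴹ Γ (snd p) (B [ fst p ]₀))
  Sg-β₁    : ∀ {Γ A B a b} → MDer (typeᴹ (A ∷ Γ) B) → MDer (termᴹ Γ a A) →
             MDer (termᴹ Γ b (B [ a ]₀)) → MDer (tmEqᴹ Γ (fst (pair a b)) a A)
  Sg-β₂    : ∀ {Γ A B a b} → MDer (typeᴹ (A ∷ Γ) B) → MDer (termᴹ Γ a A) →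
             MDer (termᴹ Γ b (B [ a ]₀)) → MDer (tmEqᴹ Γ (snd (pair a b)) b (B [ a ]₀))
  One-form  : ∀ {Γ} → MDer (okᴹ Γ) → MDer (typeᴹ Γ One)
  One-intro : ∀ {Γ} → MDer (okᴹ Γ) → MDer (termᴹ Γ star One)
  One-elim  : ∀ {Γ C c e} → MDer (typeᴹ (One ∷ Γ) C) → MDer (termᴹ Γ c (C [ star ]₀)) →
              MDer (termᴹ Γ e One) → MDer (termᴹ Γ (ind1 C c e) (C [ e ]₀))
  One-β     : ∀ {Γ C c} → MDer (typeᴹ (One ∷ Γ) C) → MDer (termᴹ Γ c (C [ star ]₀)) →
              MDer (tmEqᴹ Γ (ind1 C c star) c (C [ star ]₀))
  Sum-form  : ∀ {Γ A B} → MDer (typeᴹ Γ A) → MDer (typeᴹ Γ B) → MDer (typeᴹ Γ (Sum A B))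
  Sum-inl   : ∀ {Γ A B a} → MDer (termᴹ Γ a A) → MDer (typeᴹ Γ B) → MDer (termᴹ Γ (inl a) (Sum A B))
  Sum-inr   : ∀ {Γ A B b} → MDer (typeᴹ Γ A) → MDer (termᴹ Γ b B) → MDer (termᴹ Γ (inr b) (Sum A B))
  Sum-elim  : ∀ {Γ A B C c d e} → MDer (typeᴹ (Sum A B ∷ Γ) C) →
              MDer (termᴹ (A ∷ Γ) c (C [ inl (var 0) ]↑)) →
              MDer (termᴹ (B ∷ Γ) d (C [ inr (var 0) ]↑)) →
              MDer (termᴹ Γ e (Sum A B)) → MDer (termᴹ Γ (case C c d e) (C [ e ]₀))
  Sum-β₁    : ∀ {Γ A B C c d a} → MDer (typeᴹ (Sum A B ∷ Γ) C) →
              MDer (termᴹ (A ∷ Γ) c (C [ inl (var 0) ]↑)) →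
              MDer (termᴹ (B ∷ Γ) d (C [ inr (var 0) ]↑)) → MDer (termᴹ Γ a A) →
              MDer (tmEqᴹ Γ (case C c d (inl a)) (c [ a ]₀) (C [ inl a ]₀))
  Sum-β₂    : ∀ {Γ A B C c d b} → MDer (typeᴹ (Sum A B ∷ Γ) C) →
              MDer (termᴹ (A ∷ Γ) c (C [ inl (var 0) ]↑)) →
              MDer (termᴹ (B ∷ Γ) d (C [ inr (var 0) ]↑)) → MDer (termᴹ Γ b B) →
              MDer (tmEqᴹ Γ (case C c d (inr b)) (d [ b ]₀) (C [ inr b ]₀))
  Zero-form : ∀ {Γ} → MDer (okᴹ Γ) → MDer (typeᴹ Γ Zero)
  Zero-elim : ∀ {Γ C e} → MDer (typeᴹ (Zero ∷ Γ) C) → MDer (termᴹ Γ e Zero) →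
              MDer (termᴹ Γ (abort C e) (C [ e ]₀))
  U-form    : ∀ {Γ} → MDer (okᴹ Γ) → MDer (typeᴹ Γ U)
  El-form   : ∀ {Γ a} → MDer (termᴹ Γ a U) → MDer (typeᴹ Γ (El a))
  piᶜ-intro : ∀ {Γ a b} → MDer (termᴹ Γ a U) → MDer (termᴹ (El a ∷ Γ) b U) → MDer (termᴹ Γ (piᶜ a b) U)
  sgᶜ-intro : ∀ {Γ a b} → MDer (termᴹ Γ a U) → MDer (termᴹ (El a ∷ Γ) b U) → MDer (termᴹ Γ (sgᶜ a b) U)
  sumᶜ-intro : ∀ {Γ a b} → MDer (termᴹ Γ a U) → MDer (termᴹ Γ b U) → MDer (termᴹ Γ (sumᶜ a b) U)
  oneᶜ-intro : ∀ {Γ} → MDer (okᴹ Γ) → MDer (termᴹ Γ oneᶜ U)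
  zeroᶜ-intro : ∀ {Γ} → MDer (okᴹ Γ) → MDer (termᴹ Γ zeroᶜ U)
  El-piᶜ    : ∀ {Γ a b} → MDer (termᴹ Γ a U) → MDer (termᴹ (El a ∷ Γ) b U) →
              MDer (tyEqᴹ Γ (El (piᶜ a b)) (Pi (El a) (El b)))
  El-sgᶜ    : ∀ {Γ a b} → MDer (termᴹ Γ a U) → MDer (termᴹ (El a ∷ Γ) b U) →
              MDer (tyEqᴹ Γ (El (sgᶜ a b)) (Sg (El a) (El b)))
  El-sumᶜ   : ∀ {Γ a b} → MDer (termᴹ Γ a U) → MDer (termᴹ Γ b U) →
              MDer (tyEqᴹ Γ (El (sumᶜ a b)) (Sum (El a) (El b)))
  El-oneᶜ   : ∀ {Γ} → MDer (okᴹ Γ) → MDer (tyEqᴹ Γ (El oneᶜ) One)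
  El-zeroᶜ  : ∀ {Γ} → MDer (okᴹ Γ) → MDer (tyEqᴹ Γ (El zeroᶜ) Zero)
  ty-refl  : ∀ {Γ A} → MDer (typeᴹ Γ A) → MDer (tyEqᴹ Γ A A)
  ty-sym   : ∀ {Γ A B} → MDer (tyEqᴹ Γ A B) → MDer (tyEqᴹ Γ B A)
  ty-trans : ∀ {Γ A B C} → MDer (tyEqᴹ Γ A B) → MDer (tyEqᴹ Γ B C) → MDer (tyEqᴹ Γ A C)
  tm-refl  : ∀ {Γ t A} → MDer (termᴹ Γ t A) → MDer (tmEqᴹ Γ t t A)
  tm-sym   : ∀ {Γ t u A} → MDer (tmEqᴹ Γ t u A) → MDer (tmEqᴹ Γ u t A)
  tm-trans : ∀ {Γ t u v A} → MDer (tmEqᴹ Γ t u A) → MDer (tmEqᴹ Γ u v A) → MDer (tmEqᴹ Γ t v A)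
  Pi-cong  : ∀ {Γ A A' B B'} → MDer (typeᴹ Γ A) → MDer (tyEqᴹ Γ A A') → MDer (tyEqᴹ (A ∷ Γ) B B') →
             MDer (tyEqᴹ Γ (Pi A B) (Pi A' B'))
  Sg-cong  : ∀ {Γ A A' B B'} → MDer (typeᴹ Γ A) → MDer (tyEqᴹ Γ A A') → MDer (tyEqᴹ (A ∷ Γ) B B') →
             MDer (tyEqᴹ Γ (Sg A B) (Sg A' B'))
  Sum-cong : ∀ {Γ A A' B B'} → MDer (tyEqᴹ Γ A A') → MDer (tyEqᴹ Γ B B') →
             MDer (tyEqᴹ Γ (Sum A B) (Sum A' B'))
  El-cong  : ∀ {Γ a a'} → MDer (tmEqᴹ Γ a a' U) → MDer (tyEqᴹ Γ (El a) (El a'))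
  lam-cong : ∀ {Γ A B b b'} → MDer (typeᴹ Γ A) → MDer (tmEqᴹ (A ∷ Γ) b b' B) →
             MDer (tmEqᴹ Γ (lam b) (lam b') (Pi A B))
  app-cong : ∀ {Γ A B f f' a a'} → MDer (tmEqᴹ Γ f f' (Pi A B)) → MDer (tmEqᴹ Γ a a' A) →
             MDer (tmEqᴹ Γ (app f a) (app f' a') (B [ a ]₀))
  pair-cong : ∀ {Γ A B a a' b b'} → MDer (typeᴹ (A ∷ Γ) B) → MDer (tmEqᴹ Γ a a' A) →
              MDer (tmEqᴹ Γ b b' (B [ a ]₀)) → MDer (tmEqᴹ Γ (pair a b) (pair a' b') (Sg A B))
  fst-cong : ∀ {Γ A B p p'} → MDer (tmEqᴹ Γ p p' (Sg A B)) → MDer (tmEqᴹ Γ (fst p) (fst p') A)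
  snd-cong : ∀ {Γ A B p p'} → MDer (tmEqᴹ Γ p p' (Sg A B)) →
             MDer (tmEqᴹ Γ (snd p) (snd p') (B [ fst p ]₀))
  inl-cong : ∀ {Γ A B a a'} → MDer (tmEqᴹ Γ a a' A) → MDer (typeᴹ Γ B) →
             MDer (tmEqᴹ Γ (inl a) (inl a') (Sum A B))
  inr-cong : ∀ {Γ A B b b'} → MDer (typeᴹ Γ A) → MDer (tmEqᴹ Γ b b' B) →
             MDer (tmEqᴹ Γ (inr b) (inr b') (Sum A B))
  case-cong : ∀ {Γ A B C C' c c' d d' e e'} → MDer (tyEqᴹ (Sum A B ∷ Γ) C C') →
              MDer (tmEqᴹ (A ∷ Γ) c c' (C [ inl (var 0) ]↑)) →
              MDer (tmEqᴹ (B ∷ Γ) d d' (C [ inr (var 0) ]↑)) →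
              MDer (tmEqᴹ Γ e e' (Sum A B)) →
              MDer (tmEqᴹ Γ (case C c d e) (case C' c' d' e') (C [ e ]₀))
  abort-cong : ∀ {Γ C C' e e'} → MDer (tyEqᴹ (Zero ∷ Γ) C C') → MDer (tmEqᴹ Γ e e' Zero) →
               MDer (tmEqᴹ Γ (abort C e) (abort C' e') (C [ e ]₀))
  ind1-cong : ∀ {Γ C C' c c' e e'} → MDer (tyEqᴹ (One ∷ Γ) C C') →
              MDer (tmEqᴹ Γ c c' (C [ star ]₀)) → MDer (tmEqᴹ Γ e e' One) →
              MDer (tmEqᴹ Γ (ind1 C c e) (ind1 C' c' e') (C [ e ]₀))
  piᶜ-cong : ∀ {Γ a a' b b'} → MDer (tmEqᴹ Γ a a' U) → MDer (tmEqᴹ (El a ∷ Γ) b b' U) →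
             MDer (tmEqᴹ Γ (piᶜ a b) (piᶜ a' b') U)
  sgᶜ-cong : ∀ {Γ a a' b b'} → MDer (tmEqᴹ Γ a a' U) → MDer (tmEqᴹ (El a ∷ Γ) b b' U) →
             MDer (tmEqᴹ Γ (sgᶜ a b) (sgᶜ a' b') U)
  sumᶜ-cong : ∀ {Γ a a' b b'} → MDer (tmEqᴹ Γ a a' U) → MDer (tmEqᴹ Γ b b' U) →
              MDer (tmEqᴹ Γ (sumᶜ a b) (sumᶜ a' b') U)

appMany : Tm → List Tm → Tm
appMany f [] = f
appMany f (a ∷ as) = appMany (app f a) as

appAll : Tm → List Tm → Tm
appAll f [] = app f star
appAll f (a ∷ as) = appMany (app f a) as

piAll : List Tm → Tm → Tm
piAll [] B = B
piAll (A ∷ As) B = Pi A (piAll As B)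

sigmas : List Tm → Tm
sigmas [] = One
sigmas (A ∷ []) = A
sigmas (A ∷ B ∷ As) = Sg A (sigmas (B ∷ As))

proj : (m : ℕ) → Fin m → Tm → Tm
proj (suc zero) Fin.zero t = t
proj (suc zero) (Fin.suc ())
proj (suc (suc m)) Fin.zero t = fst t
proj (suc (suc m)) (Fin.suc i) t = proj (suc m) i (snd t)

module _ (L : FOLDS) where
  open FOLDS L

  -- sort expressions K(x_f)_{f ∈ K//L}, variables are names in ℕ
  Sort : Set
  Sort = Σ (Fin nObj) (λ K → Vec ℕ (nArr K))

  data Formula : Set where
    ⊥ᶠ ⊤ᶠ : Formula
    _∧ᶠ_ _∨ᶠ_ _⇒ᶠ_ : Formula → Formula → Formula
    ∀ᶠ ∃ᶠ : ℕ → Sort → Formula → Formula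

  data Ctx : Set where
    ∅ : Ctx
    _,_∶_ : Ctx → ℕ → Sort → Ctx

  _⧺_ : Ctx → Ctx → Ctx
  Γ ⧺ ∅ = Γ
  Γ ⧺ (Δ , x ∶ S) = (Γ ⧺ Δ) , x ∶ S

  _∉_ : ℕ → Ctx → Set
  x ∉ ∅ = ⊤
  x ∉ (Γ , y ∶ S) = (x ≢ y) × (x ∉ Γ)

  subSort : (K : Fin nObj) → Vec ℕ (nArr K) → (f : Fin (nArr K)) → Sort
  subSort K xs f = cod K f , tabulate (λ p → lookup xs (comp K f p))

  data LJudgment : Set where
    okˡ   : Ctx → LJudgment
    sortˡ : Ctx → Sort → LJudgment
    varˡ  : Ctx → ℕ → Sort → LJudgment
    formˡ : Ctx → Formula → LJudgment

  data LDer : LJudgment → Set where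
    ok-∅    : LDer (okˡ ∅)
    ok-ext  : ∀ {Γ S x} → LDer (sortˡ Γ S) → x ∉ Γ → LDer (okˡ (Γ , x ∶ S))
    wk-sort : ∀ {Γ S S' x} → LDer (sortˡ Γ S) → LDer (okˡ (Γ , x ∶ S')) →
              LDer (sortˡ (Γ , x ∶ S') S)
    wk-form : ∀ {Γ φ S' x} → LDer (formˡ Γ φ) → LDer (okˡ (Γ , x ∶ S')) →
              LDer (formˡ (Γ , x ∶ S') φ)
    var     : ∀ {Γ x S Δ} → LDer (okˡ ((Γ , x ∶ S) ⧺ Δ)) → LDer (varˡ ((Γ , x ∶ S) ⧺ Δ) x S)
    sort    : ∀ {Γ K xs} →
              ((f : Fin (nArr K)) → LDer (varˡ Γ (lookup xs f) (subSort K xs f))) →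
              (nArr K ≡ 0 → LDer (okˡ Γ)) →
              LDer (sortˡ Γ (K , xs))
    ⊥-form  : ∀ {Γ} → LDer (okˡ Γ) → LDer (formˡ Γ ⊥ᶠ)
    ⊤-form  : ∀ {Γ} → LDer (okˡ Γ) → LDer (formˡ Γ ⊤ᶠ)
    ∧-form  : ∀ {Γ φ ψ} → LDer (formˡ Γ φ) → LDer (formˡ Γ ψ) → LDer (formˡ Γ (φ ∧ᶠ ψ))
    ∨-form  : ∀ {Γ φ ψ} → LDer (formˡ Γ φ) → LDer (formˡ Γ ψ) → LDer (formˡ Γ (φ ∨ᶠ ψ))
    ⇒-form  : ∀ {Γ φ ψ} → LDer (formˡ Γ φ) → LDer (formˡ Γ ψ) → LDer (formˡ Γ (φ ⇒ᶠ ψ))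
    ∀-form  : ∀ {Γ x S φ} → LDer (okˡ Γ) → LDer (formˡ (Γ , x ∶ S) φ) → LDer (formˡ Γ (∀ᶠ x S φ))
    ∃-form  : ∀ {Γ x S φ} → LDer (okˡ Γ) → LDer (formˡ (Γ , x ∶ S) φ) → LDer (formˡ Γ (∃ᶠ x S φ))

  -- type of the variable f (the k-th arrow of K//L) inside T_K: it lives
  -- under the variables K₀,…,K_{K-1} (objects) and then the earlier arrows
  -- 0,…,k-1 of K//L
  Dom : (K : Fin nObj) → Fin (nArr K) → Tm
  Dom K k = El (appAll (var (toℕ k + (toℕ K ∸ suc (toℕ (cod K k)))))
                       (map (λ p → var (toℕ k ∸ suc (toℕ (comp K k p))))
                            (allFin (nArr (cod K k)))))

  piOrOne : List Tm → Tm
  piOrOne [] = Pi One U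
  piOrOne (A ∷ As) = piAll (A ∷ As) U

  TK : Fin nObj → Tm
  TK K = piOrOne (map (Dom K) (allFin (nArr K)))

  Struc : Tm
  Struc = sigmas (map TK (allFin nObj))

  len : Ctx → ℕ
  len ∅ = 0
  len (Γ , x ∶ S) = suc (len Γ)

  -- de Bruijn index of the name x in Γ (junk value if x is unbound)
  idx : Ctx → ℕ → ℕ
  idx ∅ x = 0
  idx (Γ , y ∶ S) x with x ≟ y
  ... | yes _ = 0
  ... | no _ = suc (idx Γ x)

  -- K^𝓜 , where 𝓜 is the outermost variable
  objᴹ : Ctx → Fin nObj → Tm
  objᴹ Γ K = proj nObj K (var (len Γ))

  ⟦_⟧S : Sort → Ctx → Tm
  ⟦ K , xs ⟧S Γ = El (appAll (objᴹ Γ K) (map (λ x → var (idx Γ x)) (Vec.toList xs)))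

  ⟦_⟧F : Formula → Ctx → Tm
  ⟦ ⊥ᶠ ⟧F Γ = Zero
  ⟦ ⊤ᶠ ⟧F Γ = One
  ⟦ φ ∧ᶠ ψ ⟧F Γ = Sg (⟦ φ ⟧F Γ) (wk (⟦ ψ ⟧F Γ))
  ⟦ φ ∨ᶠ ψ ⟧F Γ = Sum (⟦ φ ⟧F Γ) (⟦ ψ ⟧F Γ)
  ⟦ φ ⇒ᶠ ψ ⟧F Γ = Pi (⟦ φ ⟧F Γ) (wk (⟦ ψ ⟧F Γ))
  ⟦ ∀ᶠ x S φ ⟧F Γ = Pi (⟦ S ⟧S Γ) (⟦ φ ⟧F (Γ , x ∶ S))
  ⟦ ∃ᶠ x S φ ⟧F Γ = Sg (⟦ S ⟧S Γ) (⟦ φ ⟧F (Γ , x ∶ S))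

  ⟦_⟧C : Ctx → MCtx
  ⟦ ∅ ⟧C = Struc ∷ []
  ⟦ Γ , x ∶ S ⟧C = ⟦ S ⟧S Γ ∷ ⟦ Γ ⟧C

  ⟦_⟧J : LJudgment → MJudgment
  ⟦ okˡ Γ ⟧J = okᴹ ⟦ Γ ⟧C
  ⟦ sortˡ Γ S ⟧J = typeᴹ ⟦ Γ ⟧C (⟦ S ⟧S Γ)
  ⟦ varˡ Γ x S ⟧J = termᴹ ⟦ Γ ⟧C (var (idx Γ x)) (⟦ S ⟧S Γ)
  ⟦ formˡ Γ φ ⟧J = typeᴹ ⟦ Γ ⟧C (⟦ φ ⟧F Γ)

-- Soundness is proved by induction on LTT derivations, after generalising from the
-- canonical context ⟦Γ⟧ to any MLTT context in which some variable 𝓜 has type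
-- Struc(L) and every LTT variable y : S is realised by a variable of type ⟦S⟧.
-- The substance is that Struc(L) is a type at all: T_K is a Π-telescope over the
-- arrows f ∈ K//L, and the type of f mentions only K_f, which precedes K, and the
-- variables for the arrows p∘f, which precede f; functoriality of composition makes
-- these types agree with the ones T_{K_f} prescribes for its arguments.  The same
-- bookkeeping types a sort K(x_f): project K^𝓜 out of 𝓜 and apply it to the x_f.

module Submission where

open import Defs

open import Data.Nat using (ℕ; zero; suc; _+_; _∸_; _<_; _≤_; _≟_; s≤s; z≤n)
open import Data.Nat.Properties
  using (+-suc; +-comm; +-identityʳ; +-∸-assoc; m+[n∸m]≡n; m+n∸n≡m; n∸n≡0; ≤-pred; ≤∧≢⇒<; <⇒≤)
open import Data.Nat.Solver using (module +-*-Solver)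
open import Data.Fin as Fin using (Fin; toℕ)
open import Data.Fin.Properties using (toℕ-injective)
open import Data.Vec as Vec using (Vec; lookup)
open import Data.Vec.Properties using (lookup∘tabulate)
open import Data.List as List using ([]; _∷_; map; allFin)
open import Data.List.Properties using (map-tabulate; tabulate-cong; map-∘)
open import Data.Product using (Σ; _,_; _×_; proj₁; proj₂)
open import Data.Empty using (⊥; ⊥-elim)
open import Relation.Nullary using (yes; no)
open import Relation.Binary.PropositionalEquality
  using (_≡_; _≢_; refl; sym; trans; cong; cong₂; subst; subst₂; module ≡-Reasoning)

private
  cong₃ : ∀ {A B C D : Set} (f : A → B → C → D) {a a' b b' c c'} →
          a ≡ a' → b ≡ b' → c ≡ c' → f a b c ≡ f a' b' c'
  cong₃ f refl refl refl = refl

  cong₄ : ∀ {A B C D E : Set} (f : A → B → C → D → E) {a a' b b' c c' d d'} →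
          a ≡ a' → b ≡ b' → c ≡ c' → d ≡ d' → f a b c d ≡ f a' b' c' d'
  cong₄ f refl refl refl refl = refl

liftR-∘ : ∀ {a b c : ℕ → ℕ} → (∀ x → a (b x) ≡ c x) → ∀ x → liftR a (liftR b x) ≡ liftR c x
liftR-∘ h zero = refl
liftR-∘ h (suc x) = cong suc (h x)

ren-ren : ∀ {a b c : ℕ → ℕ} → (∀ x → a (b x) ≡ c x) → ∀ t → ren a (ren b t) ≡ ren c t
ren-ren h (var n) = cong var (h n)
ren-ren h (Pi A B) = cong₂ Pi (ren-ren h A) (ren-ren (liftR-∘ h) B)
ren-ren h (Sg A B) = cong₂ Sg (ren-ren h A) (ren-ren (liftR-∘ h) B)
ren-ren h (Sum A B) = cong₂ Sum (ren-ren h A) (ren-ren h B)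
ren-ren h One = refl
ren-ren h Zero = refl
ren-ren h U = refl
ren-ren h (El a) = cong El (ren-ren h a)
ren-ren h (lam b) = cong lam (ren-ren (liftR-∘ h) b)
ren-ren h (app f a) = cong₂ app (ren-ren h f) (ren-ren h a)
ren-ren h (pair a b) = cong₂ pair (ren-ren h a) (ren-ren h b)
ren-ren h (fst p) = cong fst (ren-ren h p)
ren-ren h (snd p) = cong snd (ren-ren h p)
ren-ren h star = refl
ren-ren h (inl a) = cong inl (ren-ren h a)
ren-ren h (inr b) = cong inr (ren-ren h b)
ren-ren h (case C c d e) =
  cong₄ case (ren-ren (liftR-∘ h) C) (ren-ren (liftR-∘ h) c) (ren-ren (liftR-∘ h) d) (ren-ren h e)
ren-ren h (abort C e) = cong₂ abort (ren-ren (liftR-∘ h) C) (ren-ren h e)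
ren-ren h (ind1 C c e) = cong₃ ind1 (ren-ren (liftR-∘ h) C) (ren-ren h c) (ren-ren h e)
ren-ren h (piᶜ a b) = cong₂ piᶜ (ren-ren h a) (ren-ren (liftR-∘ h) b)
ren-ren h (sgᶜ a b) = cong₂ sgᶜ (ren-ren h a) (ren-ren (liftR-∘ h) b)
ren-ren h (sumᶜ a b) = cong₂ sumᶜ (ren-ren h a) (ren-ren h b)
ren-ren h oneᶜ = refl
ren-ren h zeroᶜ = refl

liftS-liftR : ∀ {a : ℕ → Tm} {b : ℕ → ℕ} {c} → (∀ x → a (b x) ≡ c x) →
              ∀ x → liftS a (liftR b x) ≡ liftS c x
liftS-liftR h zero = refl
liftS-liftR h (suc x) = cong wk (h x)

sub-ren : ∀ {a : ℕ → Tm} {b : ℕ → ℕ} {c} → (∀ x → a (b x) ≡ c x) → ∀ t → sub a (ren b t) ≡ sub c t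
sub-ren h (var n) = h n
sub-ren h (Pi A B) = cong₂ Pi (sub-ren h A) (sub-ren (liftS-liftR h) B)
sub-ren h (Sg A B) = cong₂ Sg (sub-ren h A) (sub-ren (liftS-liftR h) B)
sub-ren h (Sum A B) = cong₂ Sum (sub-ren h A) (sub-ren h B)
sub-ren h One = refl
sub-ren h Zero = refl
sub-ren h U = refl
sub-ren h (El a) = cong El (sub-ren h a)
sub-ren h (lam b) = cong lam (sub-ren (liftS-liftR h) b)
sub-ren h (app f a) = cong₂ app (sub-ren h f) (sub-ren h a)
sub-ren h (pair a b) = cong₂ pair (sub-ren h a) (sub-ren h b)
sub-ren h (fst p) = cong fst (sub-ren h p)
sub-ren h (snd p) = cong snd (sub-ren h p)
sub-ren h star = refl
sub-ren h (inl a) = cong inl (sub-ren h a)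
sub-ren h (inr b) = cong inr (sub-ren h b)
sub-ren h (case C c d e) =
  cong₄ case (sub-ren (liftS-liftR h) C) (sub-ren (liftS-liftR h) c) (sub-ren (liftS-liftR h) d) (sub-ren h e)
sub-ren h (abort C e) = cong₂ abort (sub-ren (liftS-liftR h) C) (sub-ren h e)
sub-ren h (ind1 C c e) = cong₃ ind1 (sub-ren (liftS-liftR h) C) (sub-ren h c) (sub-ren h e)
sub-ren h (piᶜ a b) = cong₂ piᶜ (sub-ren h a) (sub-ren (liftS-liftR h) b)
sub-ren h (sgᶜ a b) = cong₂ sgᶜ (sub-ren h a) (sub-ren (liftS-liftR h) b)
sub-ren h (sumᶜ a b) = cong₂ sumᶜ (sub-ren h a) (sub-ren h b)
sub-ren h oneᶜ = refl
sub-ren h zeroᶜ = refl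

liftR-liftS : ∀ {a : ℕ → ℕ} {b c : ℕ → Tm} → (∀ x → ren a (b x) ≡ c x) →
              ∀ x → ren (liftR a) (liftS b x) ≡ liftS c x
liftR-liftS h zero = refl
liftR-liftS {a} {b} h (suc x) =
  trans (ren-ren (λ _ → refl) (b x)) (trans (sym (ren-ren (λ _ → refl) (b x))) (cong wk (h x)))

ren-sub : ∀ {a : ℕ → ℕ} {b c : ℕ → Tm} → (∀ x → ren a (b x) ≡ c x) → ∀ t → ren a (sub b t) ≡ sub c t
ren-sub h (var n) = h n
ren-sub h (Pi A B) = cong₂ Pi (ren-sub h A) (ren-sub (liftR-liftS h) B)
ren-sub h (Sg A B) = cong₂ Sg (ren-sub h A) (ren-sub (liftR-liftS h) B)
ren-sub h (Sum A B) = cong₂ Sum (ren-sub h A) (ren-sub h B)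
ren-sub h One = refl
ren-sub h Zero = refl
ren-sub h U = refl
ren-sub h (El a) = cong El (ren-sub h a)
ren-sub h (lam b) = cong lam (ren-sub (liftR-liftS h) b)
ren-sub h (app f a) = cong₂ app (ren-sub h f) (ren-sub h a)
ren-sub h (pair a b) = cong₂ pair (ren-sub h a) (ren-sub h b)
ren-sub h (fst p) = cong fst (ren-sub h p)
ren-sub h (snd p) = cong snd (ren-sub h p)
ren-sub h star = refl
ren-sub h (inl a) = cong inl (ren-sub h a)
ren-sub h (inr b) = cong inr (ren-sub h b)
ren-sub h (case C c d e) =
  cong₄ case (ren-sub (liftR-liftS h) C) (ren-sub (liftR-liftS h) c) (ren-sub (liftR-liftS h) d) (ren-sub h e)
ren-sub h (abort C e) = cong₂ abort (ren-sub (liftR-liftS h) C) (ren-sub h e)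
ren-sub h (ind1 C c e) = cong₃ ind1 (ren-sub (liftR-liftS h) C) (ren-sub h c) (ren-sub h e)
ren-sub h (piᶜ a b) = cong₂ piᶜ (ren-sub h a) (ren-sub (liftR-liftS h) b)
ren-sub h (sgᶜ a b) = cong₂ sgᶜ (ren-sub h a) (ren-sub (liftR-liftS h) b)
ren-sub h (sumᶜ a b) = cong₂ sumᶜ (ren-sub h a) (ren-sub h b)
ren-sub h oneᶜ = refl
ren-sub h zeroᶜ = refl

liftS-liftS : ∀ {a b c : ℕ → Tm} → (∀ x → sub a (b x) ≡ c x) →
              ∀ x → sub (liftS a) (liftS b x) ≡ liftS c x
liftS-liftS h zero = refl
liftS-liftS {a} {b} h (suc x) =
  trans (sub-ren (λ _ → refl) (b x)) (trans (sym (ren-sub (λ _ → refl) (b x))) (cong wk (h x)))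

sub-sub : ∀ {a b c : ℕ → Tm} → (∀ x → sub a (b x) ≡ c x) → ∀ t → sub a (sub b t) ≡ sub c t
sub-sub h (var n) = h n
sub-sub h (Pi A B) = cong₂ Pi (sub-sub h A) (sub-sub (liftS-liftS h) B)
sub-sub h (Sg A B) = cong₂ Sg (sub-sub h A) (sub-sub (liftS-liftS h) B)
sub-sub h (Sum A B) = cong₂ Sum (sub-sub h A) (sub-sub h B)
sub-sub h One = refl
sub-sub h Zero = refl
sub-sub h U = refl
sub-sub h (El a) = cong El (sub-sub h a)
sub-sub h (lam b) = cong lam (sub-sub (liftS-liftS h) b)
sub-sub h (app f a) = cong₂ app (sub-sub h f) (sub-sub h a)
sub-sub h (pair a b) = cong₂ pair (sub-sub h a) (sub-sub h b)
sub-sub h (fst p) = cong fst (sub-sub h p)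
sub-sub h (snd p) = cong snd (sub-sub h p)
sub-sub h star = refl
sub-sub h (inl a) = cong inl (sub-sub h a)
sub-sub h (inr b) = cong inr (sub-sub h b)
sub-sub h (case C c d e) =
  cong₄ case (sub-sub (liftS-liftS h) C) (sub-sub (liftS-liftS h) c) (sub-sub (liftS-liftS h) d) (sub-sub h e)
sub-sub h (abort C e) = cong₂ abort (sub-sub (liftS-liftS h) C) (sub-sub h e)
sub-sub h (ind1 C c e) = cong₃ ind1 (sub-sub (liftS-liftS h) C) (sub-sub h c) (sub-sub h e)
sub-sub h (piᶜ a b) = cong₂ piᶜ (sub-sub h a) (sub-sub (liftS-liftS h) b)
sub-sub h (sgᶜ a b) = cong₂ sgᶜ (sub-sub h a) (sub-sub (liftS-liftS h) b)
sub-sub h (sumᶜ a b) = cong₂ sumᶜ (sub-sub h a) (sub-sub h b)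
sub-sub h oneᶜ = refl
sub-sub h zeroᶜ = refl

liftS-var : ∀ {a : ℕ → Tm} → (∀ x → a x ≡ var x) → ∀ x → liftS a x ≡ var x
liftS-var h zero = refl
liftS-var h (suc x) = cong wk (h x)

sub-id : ∀ {a : ℕ → Tm} → (∀ x → a x ≡ var x) → ∀ t → sub a t ≡ t
sub-id h (var n) = h n
sub-id h (Pi A B) = cong₂ Pi (sub-id h A) (sub-id (liftS-var h) B)
sub-id h (Sg A B) = cong₂ Sg (sub-id h A) (sub-id (liftS-var h) B)
sub-id h (Sum A B) = cong₂ Sum (sub-id h A) (sub-id h B)
sub-id h One = refl
sub-id h Zero = refl
sub-id h U = refl
sub-id h (El a) = cong El (sub-id h a)
sub-id h (lam b) = cong lam (sub-id (liftS-var h) b)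
sub-id h (app f a) = cong₂ app (sub-id h f) (sub-id h a)
sub-id h (pair a b) = cong₂ pair (sub-id h a) (sub-id h b)
sub-id h (fst p) = cong fst (sub-id h p)
sub-id h (snd p) = cong snd (sub-id h p)
sub-id h star = refl
sub-id h (inl a) = cong inl (sub-id h a)
sub-id h (inr b) = cong inr (sub-id h b)
sub-id h (case C c d e) =
  cong₄ case (sub-id (liftS-var h) C) (sub-id (liftS-var h) c) (sub-id (liftS-var h) d) (sub-id h e)
sub-id h (abort C e) = cong₂ abort (sub-id (liftS-var h) C) (sub-id h e)
sub-id h (ind1 C c e) = cong₃ ind1 (sub-id (liftS-var h) C) (sub-id h c) (sub-id h e)
sub-id h (piᶜ a b) = cong₂ piᶜ (sub-id h a) (sub-id (liftS-var h) b)
sub-id h (sgᶜ a b) = cong₂ sgᶜ (sub-id h a) (sub-id (liftS-var h) b)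
sub-id h (sumᶜ a b) = cong₂ sumᶜ (sub-id h a) (sub-id h b)
sub-id h oneᶜ = refl
sub-id h zeroᶜ = refl

sub-var : ∀ t → sub var t ≡ t
sub-var = sub-id (λ _ → refl)

sub-cong : ∀ {a b : ℕ → Tm} → (∀ x → a x ≡ b x) → ∀ t → sub a t ≡ sub b t
sub-cong h t = trans (cong (sub _) (sym (sub-var t))) (sub-sub h t)

infixr 5 _∷ˢ_
_∷ˢ_ : Tm → (ℕ → Tm) → ℕ → Tm
(a ∷ˢ σ) zero = a
(a ∷ˢ σ) (suc n) = σ n

[]₀≡sub-∷ˢ : ∀ B a → B [ a ]₀ ≡ sub (a ∷ˢ var) B
[]₀≡sub-∷ˢ B a = sub-cong (λ { zero → refl ; (suc n) → refl }) B

sub-liftS-[]₀ : ∀ σ B a → (sub (liftS σ) B) [ a ]₀ ≡ sub (a ∷ˢ σ) B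
sub-liftS-[]₀ σ B a = trans ([]₀≡sub-∷ˢ (sub (liftS σ) B) a) (sub-sub instantiate B)
  where
  instantiate : ∀ x → sub (a ∷ˢ var) (liftS σ x) ≡ (a ∷ˢ σ) x
  instantiate zero = refl
  instantiate (suc n) = trans (sub-ren (λ _ → refl) (σ n)) (sub-var (σ n))

shift : ℕ → ℕ → Tm
shift p x = var (x + p)

wk-sub : ∀ σ T → wk (sub σ T) ≡ sub (λ x → wk (σ x)) T
wk-sub σ T = ren-sub (λ _ → refl) T

wk-sub-shift : ∀ p T → wk (sub (shift p) T) ≡ sub (shift (suc p)) T
wk-sub-shift p T = ren-sub (λ x → cong var (sym (+-suc x p))) T

wk≡sub-shift : ∀ T → wk T ≡ sub (shift 1) T
wk≡sub-shift T = trans (cong wk (sym (sub-var T))) (ren-sub (λ x → cong var (+-comm 1 x)) T)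

sub-appMany : ∀ σ h as → sub σ (appMany h as) ≡ appMany (sub σ h) (map (sub σ) as)
sub-appMany σ h [] = refl
sub-appMany σ h (a ∷ as) = sub-appMany σ (app h a) as

sub-appAll : ∀ σ h as → sub σ (appAll h as) ≡ appAll (sub σ h) (map (sub σ) as)
sub-appAll σ h [] = refl
sub-appAll σ h (a ∷ as) = sub-appMany σ (app h a) as

ren-appMany : ∀ ρ h as → ren ρ (appMany h as) ≡ appMany (ren ρ h) (map (ren ρ) as)
ren-appMany ρ h [] = refl
ren-appMany ρ h (a ∷ as) = ren-appMany ρ (app h a) as

ren-appAll : ∀ ρ h as → ren ρ (appAll h as) ≡ appAll (ren ρ h) (map (ren ρ) as)
ren-appAll ρ h [] = refl
ren-appAll ρ h (a ∷ as) = ren-appMany ρ (app h a) as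

ren-proj : ∀ ρ n i t → ren ρ (proj n i t) ≡ proj n i (ren ρ t)
ren-proj ρ (suc zero) Fin.zero t = refl
ren-proj ρ (suc (suc n)) Fin.zero t = refl
ren-proj ρ (suc (suc n)) (Fin.suc i) t = ren-proj ρ (suc n) i (snd t)

map-var-allFin : ∀ n (g : Fin n → ℕ) → map (λ p → var (g p)) (allFin n) ≡ List.tabulate (λ p → var (g p))
map-var-allFin n g = map-tabulate (λ i → i) (λ p → Tm.var (g p))

sub-El-appAll-vars : ∀ σ h n (g : Fin n → ℕ) →
  sub σ (El (appAll (var h) (map (λ p → var (g p)) (allFin n)))) ≡
  El (appAll (σ h) (List.tabulate (λ p → σ (g p))))
sub-El-appAll-vars σ h n g = cong El (trans (sub-appAll σ (var h) (map (λ p → var (g p)) (allFin n)))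
  (cong (appAll (σ h)) (trans (sym (map-∘ {g = sub σ} {f = λ p → Tm.var (g p)} (allFin n)))
                              (map-tabulate (λ i → i) (λ p → σ (g p))))))

-- The i-th component of t : σ(Σ(x₀:A₀)⋯A_{n-1}) has type A_i under the substitution
-- sending the bound variables x_{i-1}, …, x₀ to the earlier components.
projEnv : (n : ℕ) → Fin n → Tm → (ℕ → Tm) → ℕ → Tm
projEnv (suc zero) Fin.zero t σ = σ
projEnv (suc (suc n)) Fin.zero t σ = σ
projEnv (suc (suc n)) (Fin.suc i) t σ = projEnv (suc n) i (snd t) (fst t ∷ˢ σ)

proj-typed : ∀ {Δ} n (A : Fin n → Tm) t σ → MDer (termᴹ Δ t (sub σ (sigmas (List.tabulate A)))) →
             ∀ i → MDer (termᴹ Δ (proj n i t) (sub (projEnv n i t σ) (A i)))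
proj-typed (suc zero) A t σ d Fin.zero = d
proj-typed (suc (suc n)) A t σ d Fin.zero = Sg-fst d
proj-typed {Δ} (suc (suc n)) A t σ d (Fin.suc i) =
  proj-typed (suc n) (λ j → A (Fin.suc j)) (snd t) (fst t ∷ˢ σ) d-snd i
  where
  d-snd : MDer (termᴹ Δ (snd t) (sub (fst t ∷ˢ σ) (sigmas (List.tabulate (λ j → A (Fin.suc j))))))
  d-snd = subst (λ T → MDer (termᴹ Δ (snd t) T))
                (sub-liftS-[]₀ σ (sigmas (List.tabulate (λ j → A (Fin.suc j)))) (fst t)) (Sg-snd d)

projEnv-outer : ∀ n i t σ x → projEnv n i t σ (toℕ i + x) ≡ σ x
projEnv-outer (suc zero) Fin.zero t σ x = refl
projEnv-outer (suc (suc n)) Fin.zero t σ x = refl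
projEnv-outer (suc (suc n)) (Fin.suc i) t σ x =
  trans (cong (projEnv (suc n) i (snd t) (fst t ∷ˢ σ)) (sym (+-suc (toℕ i) x)))
        (projEnv-outer (suc n) i (snd t) (fst t ∷ˢ σ) (suc x))

projEnv-earlier : ∀ n i c t σ → toℕ c < toℕ i → projEnv n i t σ (toℕ i ∸ suc (toℕ c)) ≡ proj n c t
projEnv-earlier (suc (suc n)) (Fin.suc i) Fin.zero t σ _ =
  trans (cong (projEnv (suc n) i (snd t) (fst t ∷ˢ σ)) (sym (+-identityʳ (toℕ i))))
        (projEnv-outer (suc n) i (snd t) (fst t ∷ˢ σ) 0)
projEnv-earlier (suc (suc n)) (Fin.suc i) (Fin.suc c) t σ (s≤s c<i) =
  projEnv-earlier (suc n) i c (snd t) (fst t ∷ˢ σ) c<i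

-- The j-th argument of f : ψ(Π(x₀:D₀)⋯D_{n-1}. 𝒰) must have type D_j under the
-- substitution sending x_{j-1}, …, x₀ to the earlier arguments.
argEnv : (n : ℕ) → (Fin n → Tm) → (ℕ → Tm) → Fin n → ℕ → Tm
argEnv (suc n) a ψ Fin.zero = ψ
argEnv (suc n) a ψ (Fin.suc j) = argEnv n (λ k → a (Fin.suc k)) (a Fin.zero ∷ˢ ψ) j

argEnv-outer : ∀ n a ψ j x → argEnv n a ψ j (toℕ j + x) ≡ ψ x
argEnv-outer (suc n) a ψ Fin.zero x = refl
argEnv-outer (suc n) a ψ (Fin.suc j) x =
  trans (cong (argEnv n (λ k → a (Fin.suc k)) (a Fin.zero ∷ˢ ψ) j) (sym (+-suc (toℕ j) x)))
        (argEnv-outer n (λ k → a (Fin.suc k)) (a Fin.zero ∷ˢ ψ) j (suc x))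

argEnv-earlier : ∀ n a ψ j q → toℕ q < toℕ j → argEnv n a ψ j (toℕ j ∸ suc (toℕ q)) ≡ a q
argEnv-earlier (suc n) a ψ (Fin.suc j) Fin.zero _ =
  trans (cong (argEnv n (λ k → a (Fin.suc k)) (a Fin.zero ∷ˢ ψ) j) (sym (+-identityʳ (toℕ j))))
        (argEnv-outer n (λ k → a (Fin.suc k)) (a Fin.zero ∷ˢ ψ) j 0)
argEnv-earlier (suc (suc n)) a ψ (Fin.suc j) (Fin.suc q) (s≤s q<j) =
  argEnv-earlier (suc n) (λ k → a (Fin.suc k)) (a Fin.zero ∷ˢ ψ) j q q<j

appMany-U : ∀ {Δ} n (D a : Fin n → Tm) ψ f →
  MDer (termᴹ Δ f (sub ψ (piAll (List.tabulate D) U))) →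
  (∀ j → MDer (termᴹ Δ (a j) (sub (argEnv n a ψ j) (D j)))) →
  MDer (termᴹ Δ (appMany f (List.tabulate a)) U)
appMany-U zero D a ψ f df da = df
appMany-U {Δ} (suc n) D a ψ f df da =
  appMany-U n (λ j → D (Fin.suc j)) (λ j → a (Fin.suc j)) (a Fin.zero ∷ˢ ψ) (app f (a Fin.zero))
    (subst (λ T → MDer (termᴹ Δ (app f (a Fin.zero)) T))
           (sub-liftS-[]₀ ψ (piAll (List.tabulate (λ j → D (Fin.suc j))) U) (a Fin.zero))
           (Pi-elim df (da Fin.zero)))
    (λ j → da (Fin.suc j))

var-zero-shift : ∀ {Γ B} → MDer (typeᴹ Γ B) → MDer (termᴹ (B ∷ Γ) (var 0) (sub (shift 1) B))
var-zero-shift {Γ} {B} d = subst (λ T → MDer (termᴹ (B ∷ Γ) (var 0) T)) (wk≡sub-shift B) (var-zero d)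

var-suc-shift : ∀ {Γ B i} p T → MDer (termᴹ Γ (var i) (sub (shift p) T)) → MDer (typeᴹ Γ B) →
                MDer (termᴹ (B ∷ Γ) (var (suc i)) (sub (shift (suc p)) T))
var-suc-shift {Γ} {B} {i} p T d dB =
  subst (λ X → MDer (termᴹ (B ∷ Γ) (var (suc i)) X)) (wk-sub-shift p T) (var-suc d dB)

-- Γ ends with variables for the entries 0, …, k-1 of the family A, followed by w
-- further variables; entry c is the variable w + (k ∸ suc c) and its type A c was
-- written in the context of the entries before it.
Telescope : ∀ {n} → (Fin n → Tm) → MCtx → ℕ → ℕ → Set
Telescope A Γ k w = ∀ c → toℕ c < k →
  MDer (termᴹ Γ (var (w + (k ∸ suc (toℕ c)))) (sub (shift (w + (k ∸ toℕ c))) (A c)))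

telescope-wk : ∀ {n} {A : Fin n → Tm} {Γ B k w} → Telescope A Γ k w → MDer (typeᴹ Γ B) →
               Telescope A (B ∷ Γ) k (suc w)
telescope-wk {A = A} {k = k} {w} tA dB c c<k = var-suc-shift (w + (k ∸ toℕ c)) (A c) (tA c c<k) dB

∸≡suc∸suc : ∀ {m n} → suc n ≤ m → m ∸ n ≡ suc (m ∸ suc n)
∸≡suc∸suc (s≤s n≤m) = +-∸-assoc 1 n≤m

telescope-ext : ∀ {n} {A : Fin n → Tm} {Γ k} (c₀ : Fin n) → toℕ c₀ ≡ k →
                Telescope A Γ k 0 → MDer (typeᴹ Γ (A c₀)) → Telescope A (A c₀ ∷ Γ) (suc k) 0
telescope-ext {A = A} {Γ} {k} c₀ refl tA dA c c<1+k with toℕ c ≟ k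
... | yes c≡k with toℕ-injective c≡k
...   | refl = subst₂ (λ i p → MDer (termᴹ (A c ∷ Γ) (var i) (sub (shift p) (A c))))
                      (sym (n∸n≡0 k)) (sym (m+n∸n≡m 1 k)) (var-zero-shift dA)
telescope-ext {A = A} {Γ} {k} c₀ refl tA dA c c<1+k | no c≢k =
  subst₂ (λ i p → MDer (termᴹ (A c₀ ∷ Γ) (var i) (sub (shift p) (A c))))
         (sym (∸≡suc∸suc c<k)) (sym (+-∸-assoc 1 (<⇒≤ c<k))) (telescope-wk {A = A} tA dA c c<k)
  where c<k = ≤∧≢⇒< (≤-pred c<1+k) c≢k

∸-split : ∀ {a b c} → a ≤ b → b ≤ c → c ∸ a ≡ (b ∸ a) + (c ∸ b)
∸-split z≤n b≤c = sym (m+[n∸m]≡n b≤c)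
∸-split (s≤s a≤b) (s≤s b≤c) = ∸-split a≤b b≤c

zero-or-Fin : ∀ {X : Set} n → (n ≡ 0 → X) → (Fin n → X) → X
zero-or-Fin zero z _ = z refl
zero-or-Fin (suc n) _ s = s Fin.zero

module _ (L : FOLDS) where
  open FOLDS L

  toℕ-cod< : ∀ K f → toℕ (cod K f) < toℕ K
  toℕ-cod< K f = <ₒ-listing (cod-<ₒ K f)

  toℕ-comp< : ∀ K f p → toℕ (comp K f p) < toℕ f
  toℕ-comp< K f p = <ₐ-listing K _ _ (<ₐ-cod K (comp K f p) K f
    (subst (_<ₒ cod K f) (sym (cod-comp K f p)) (cod-<ₒ (cod K f) p)))

  TK≡piOrOne : ∀ K → TK L K ≡ piOrOne L (List.tabulate (Dom L K))
  TK≡piOrOne K = cong (piOrOne L) (map-tabulate (λ i → i) (Dom L K))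

  Struc≡sigmas : Struc L ≡ sigmas (List.tabulate (TK L))
  Struc≡sigmas = cong sigmas (map-tabulate (λ i → i) (TK L))

  piOrOne-type : ∀ {Γ} n (D : Fin n → Tm) → MDer (okᴹ Γ) → MDer (typeᴹ Γ (piAll (List.tabulate D) U)) →
                 MDer (typeᴹ Γ (piOrOne L (List.tabulate D)))
  piOrOne-type zero D ok _ = Pi-form (One-form ok) (U-form (ctx-cons (One-form ok)))
  piOrOne-type (suc n) D ok d = d

  appAll-U : ∀ {Δ} n (D a : Fin n → Tm) ψ f → MDer (okᴹ Δ) →
    MDer (termᴹ Δ f (sub ψ (piOrOne L (List.tabulate D)))) →
    (∀ j → MDer (termᴹ Δ (a j) (sub (argEnv n a ψ j) (D j)))) →
    MDer (termᴹ Δ (appAll f (List.tabulate a)) U)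
  appAll-U zero D a ψ f ok df da = Pi-elim df (One-intro ok)
  appAll-U (suc n) D a ψ f ok df da = appMany-U (suc n) D a ψ f df da

  -- In the context of T_K after the arrows 0, …, b-1, the variable for the arrow p∘b.
  argVar : ∀ K b → Fin (nArr (cod K b)) → Tm
  argVar K b p = var (toℕ b ∸ suc (toℕ (comp K b p)))

  El-var-spine-cong : ∀ {d d'} (d≡d' : d ≡ d') {h h'} {g : Fin (nArr d) → ℕ} {g' : Fin (nArr d') → ℕ} →
    h ≡ h' → (∀ p → g (subst (λ x → Fin (nArr x)) (sym d≡d') p) ≡ g' p) →
    El (appAll (var h) (List.tabulate (λ p → Tm.var (g p)))) ≡
    El (appAll (var h') (List.tabulate (λ p → Tm.var (g' p))))
  El-var-spine-cong refl refl g≗g' =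
    cong (λ as → El (appAll (var _) as)) (tabulate-cong (λ p → cong Tm.var (g≗g' p)))

  -- The type of the variable for p∘b, seen from position b of T_K, is the type that
  -- T_{K_b} prescribes for its argument p: this is where functoriality (cod-comp, assoc)
  -- and the proper order enter.
  Dom-comp : ∀ K b q → let c = cod K b in
    sub (shift (toℕ b ∸ toℕ (comp K b q))) (Dom L K (comp K b q)) ≡
    sub (argEnv (nArr c) (argVar K b) (shift (toℕ b + (toℕ K ∸ toℕ c))) q) (Dom L c q)
  Dom-comp K b q =
    trans (sub-El-appAll-vars (shift (toℕ b ∸ toℕ e)) _ (nArr (cod K e)) _)
    (trans (El-var-spine-cong (cod-comp K b q) head≡ args≡)
    (sym (trans (sub-El-appAll-vars env _ (nArr (cod c q)) _)
      (cong₂ (λ h as → El (appAll h as))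
        (argEnv-outer (nArr c) (argVar K b) ψ q (toℕ c ∸ suc (toℕ (cod c q))))
        (tabulate-cong (λ p → argEnv-earlier (nArr c) (argVar K b) ψ q (comp c q p) (toℕ-comp< c q p)))))))
    where
    open ≡-Reasoning
    c = cod K b
    e = comp K b q
    ψ = shift (toℕ b + (toℕ K ∸ toℕ c))
    env = argEnv (nArr c) (argVar K b) ψ q
    e≤b = <⇒≤ (toℕ-comp< K b q)

    reassoc : ∀ x y z w → (x + (y + z)) + w ≡ y + ((x + w) + z)
    reassoc = solve 4 (λ x y z w → (x :+ (y :+ z)) :+ w := y :+ ((x :+ w) :+ z)) refl
      where open +-*-Solver

    head≡ : (toℕ e + (toℕ K ∸ suc (toℕ (cod K e)))) + (toℕ b ∸ toℕ e) ≡
            (toℕ c ∸ suc (toℕ (cod c q))) + (toℕ b + (toℕ K ∸ toℕ c))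
    head≡ = begin
      (toℕ e + (toℕ K ∸ suc (toℕ (cod K e)))) + (toℕ b ∸ toℕ e)
        ≡⟨ cong (λ d → (toℕ e + (toℕ K ∸ suc (toℕ d))) + (toℕ b ∸ toℕ e)) (cod-comp K b q) ⟩
      (toℕ e + (toℕ K ∸ suc (toℕ (cod c q)))) + (toℕ b ∸ toℕ e)
        ≡⟨ cong (λ z → (toℕ e + z) + (toℕ b ∸ toℕ e))
                (∸-split (toℕ-cod< c q) (<⇒≤ (toℕ-cod< K b))) ⟩
      (toℕ e + ((toℕ c ∸ suc (toℕ (cod c q))) + (toℕ K ∸ toℕ c))) + (toℕ b ∸ toℕ e)
        ≡⟨ reassoc (toℕ e) (toℕ c ∸ suc (toℕ (cod c q))) (toℕ K ∸ toℕ c) (toℕ b ∸ toℕ e) ⟩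
      (toℕ c ∸ suc (toℕ (cod c q))) + ((toℕ e + (toℕ b ∸ toℕ e)) + (toℕ K ∸ toℕ c))
        ≡⟨ cong (λ z → (toℕ c ∸ suc (toℕ (cod c q))) + (z + (toℕ K ∸ toℕ c))) (m+[n∸m]≡n e≤b) ⟩
      (toℕ c ∸ suc (toℕ (cod c q))) + (toℕ b + (toℕ K ∸ toℕ c)) ∎

    args≡ : ∀ p → let p̃ = subst (λ x → Fin (nArr x)) (sym (cod-comp K b q)) p in
            (toℕ e ∸ suc (toℕ (comp K e p̃))) + (toℕ b ∸ toℕ e) ≡
            toℕ b ∸ suc (toℕ (comp K b (comp c q p)))
    args≡ p = begin
      (toℕ e ∸ suc (toℕ (comp K e p̃))) + (toℕ b ∸ toℕ e)
        ≡⟨ cong (λ z → (toℕ e ∸ suc (toℕ z)) + (toℕ b ∸ toℕ e)) (assoc K b q p) ⟩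
      (toℕ e ∸ suc (toℕ (comp K b (comp c q p)))) + (toℕ b ∸ toℕ e)
        ≡⟨ sym (∸-split (subst (λ z → toℕ z < toℕ e) (assoc K b q p) (toℕ-comp< K e p̃)) e≤b) ⟩
      toℕ b ∸ suc (toℕ (comp K b (comp c q p))) ∎
      where p̃ = subst (λ x → Fin (nArr x)) (sym (cod-comp K b q)) p

  Dom-type : ∀ {Γ j} K b → toℕ b ≡ j → MDer (okᴹ Γ) →
             Telescope (TK L) Γ (toℕ K) j → Telescope (Dom L K) Γ j 0 → MDer (typeᴹ Γ (Dom L K b))
  Dom-type {Γ} K b refl ok objs arrs =
    El-form (subst (λ as → MDer (termᴹ Γ (appAll head as) U))
                   (sym (map-var-allFin (nArr c) (λ p → toℕ b ∸ suc (toℕ (comp K b p)))))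
                   (appAll-U (nArr c) (Dom L c) (argVar K b) ψ head ok head-typed arg-typed))
    where
    c = cod K b
    head = var (toℕ b + (toℕ K ∸ suc (toℕ c)))
    ψ = shift (toℕ b + (toℕ K ∸ toℕ c))
    head-typed : MDer (termᴹ Γ head (sub ψ (piOrOne L (List.tabulate (Dom L c)))))
    head-typed = subst (λ T → MDer (termᴹ Γ head (sub ψ T))) (TK≡piOrOne c) (objs c (toℕ-cod< K b))
    arg-typed : ∀ q → MDer (termᴹ Γ (argVar K b q) (sub (argEnv (nArr c) (argVar K b) ψ q) (Dom L c q)))
    arg-typed q = subst (λ T → MDer (termᴹ Γ (argVar K b q) T)) (Dom-comp K b q)
                        (arrs (comp K b q) (toℕ-comp< K b q))

  Dom-telescope-type : ∀ K n (g : Fin n → Fin (nArr K)) j {Γ} → (∀ i → toℕ (g i) ≡ j + toℕ i) →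
    MDer (okᴹ Γ) → Telescope (TK L) Γ (toℕ K) j → Telescope (Dom L K) Γ j 0 →
    MDer (typeᴹ Γ (piAll (List.tabulate (λ i → Dom L K (g i))) U))
  Dom-telescope-type K zero g j g≡ ok objs arrs = U-form ok
  Dom-telescope-type K (suc n) g j g≡ ok objs arrs =
    Pi-form dD (Dom-telescope-type K n (λ i → g (Fin.suc i)) (suc j)
                  (λ i → trans (g≡ (Fin.suc i)) (+-suc j (toℕ i)))
                  (ctx-cons dD) (telescope-wk {A = TK L} objs dD)
                  (telescope-ext {A = Dom L K} (g Fin.zero) g₀≡ arrs dD))
    where
    g₀≡ = trans (g≡ Fin.zero) (+-identityʳ j)
    dD = Dom-type K (g Fin.zero) g₀≡ ok objs arrs

  TK-type : ∀ {Γ k} K → toℕ K ≡ k → MDer (okᴹ Γ) → Telescope (TK L) Γ k 0 → MDer (typeᴹ Γ (TK L K))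
  TK-type {Γ} K refl ok objs = subst (λ T → MDer (typeᴹ Γ T)) (sym (TK≡piOrOne K))
    (piOrOne-type (nArr K) (Dom L K) ok
      (Dom-telescope-type K (nArr K) (λ i → i) 0 (λ _ → refl) ok objs (λ _ ())))

  TK-telescope-type : ∀ n (h : Fin n → Fin nObj) k {Γ} → (∀ i → toℕ (h i) ≡ k + toℕ i) →
    MDer (okᴹ Γ) → Telescope (TK L) Γ k 0 → MDer (typeᴹ Γ (sigmas (List.tabulate (λ i → TK L (h i)))))
  TK-telescope-type zero h k h≡ ok objs = One-form ok
  TK-telescope-type (suc zero) h k h≡ ok objs =
    TK-type (h Fin.zero) (trans (h≡ Fin.zero) (+-identityʳ k)) ok objs
  TK-telescope-type (suc (suc n)) h k h≡ ok objs =
    Sg-form dT (TK-telescope-type (suc n) (λ i → h (Fin.suc i)) (suc k)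
                  (λ i → trans (h≡ (Fin.suc i)) (+-suc k (toℕ i)))
                  (ctx-cons dT) (telescope-ext {A = TK L} (h Fin.zero) h₀≡ objs dT))
    where
    h₀≡ = trans (h≡ Fin.zero) (+-identityʳ k)
    dT = TK-type (h Fin.zero) h₀≡ ok objs

  Struc-type : MDer (typeᴹ [] (Struc L))
  Struc-type = subst (λ T → MDer (typeᴹ [] T)) (sym Struc≡sigmas)
    (TK-telescope-type nObj (λ i → i) 0 (λ _ → refl) ctx-nil (λ _ ()))

  Dom-instantiate : ∀ σ M K (a : Fin (nArr K) → Tm) j →
    sub (argEnv (nArr K) a (projEnv nObj K M σ) j) (Dom L K j) ≡
    El (appAll (proj nObj (cod K j) M) (List.tabulate (λ p → a (comp K j p))))
  Dom-instantiate σ M K a j =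
    trans (sub-El-appAll-vars env (toℕ j + (toℕ K ∸ suc (toℕ (cod K j)))) (nArr (cod K j))
                              (λ p → toℕ j ∸ suc (toℕ (comp K j p))))
      (cong₂ (λ h as → El (appAll h as))
        (trans (argEnv-outer (nArr K) a ψ j (toℕ K ∸ suc (toℕ (cod K j))))
               (projEnv-earlier nObj K (cod K j) M σ (toℕ-cod< K j)))
        (tabulate-cong (λ p → argEnv-earlier (nArr K) a ψ j (comp K j p) (toℕ-comp< K j p))))
    where
    ψ = projEnv nObj K M σ
    env = argEnv (nArr K) a ψ j

  -- The semantic counterpart of the sort-formation rule.
  appAll-component-U : ∀ {Δ} σ M → MDer (okᴹ Δ) → MDer (termᴹ Δ M (sub σ (Struc L))) →
    ∀ K (a : Fin (nArr K) → Tm) →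
    (∀ f → MDer (termᴹ Δ (a f)
                  (El (appAll (proj nObj (cod K f) M) (List.tabulate (λ p → a (comp K f p))))))) →
    MDer (termᴹ Δ (appAll (proj nObj K M) (List.tabulate a)) U)
  appAll-component-U {Δ} σ M ok dM K a da =
    appAll-U (nArr K) (Dom L K) a ψ (proj nObj K M) ok
      (subst (λ T → MDer (termᴹ Δ (proj nObj K M) (sub ψ T))) (TK≡piOrOne K) component-typed)
      (λ j → subst (λ T → MDer (termᴹ Δ (a j) T)) (sym (Dom-instantiate σ M K a j)) (da j))
    where
    ψ = projEnv nObj K M σ
    component-typed : MDer (termᴹ Δ (proj nObj K M) (sub ψ (TK L K)))
    component-typed =
      proj-typed nObj (TK L) M σ (subst (λ T → MDer (termᴹ Δ M (sub σ T))) Struc≡sigmas dM) K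

  -- ⟦ S ⟧S Γ and ⟦ φ ⟧F Γ are sortTy S m r and formTy φ m r with 𝓜 the variable
  -- m = len Γ and the LTT variable y the variable r y = idx Γ y.
  sortTy : Sort L → ℕ → (ℕ → ℕ) → Tm
  sortTy (K , xs) m r = El (appAll (proj nObj K (var m)) (map (λ x → Tm.var (r x)) (Vec.toList xs)))

  bindIdx : ℕ → (ℕ → ℕ) → ℕ → ℕ
  bindIdx x r y with y ≟ x
  ... | yes _ = 0
  ... | no _ = suc (r y)

  formTy : Formula L → ℕ → (ℕ → ℕ) → Tm
  formTy ⊥ᶠ m r = Zero
  formTy ⊤ᶠ m r = One
  formTy (φ ∧ᶠ ψ) m r = Sg (formTy φ m r) (formTy ψ (suc m) (λ y → suc (r y)))
  formTy (φ ∨ᶠ ψ) m r = Sum (formTy φ m r) (formTy ψ m r)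
  formTy (φ ⇒ᶠ ψ) m r = Pi (formTy φ m r) (formTy ψ (suc m) (λ y → suc (r y)))
  formTy (∀ᶠ x S φ) m r = Pi (sortTy S m r) (formTy φ (suc m) (bindIdx x r))
  formTy (∃ᶠ x S φ) m r = Sg (sortTy S m r) (formTy φ (suc m) (bindIdx x r))

  bindIdx-self : ∀ x r → bindIdx x r x ≡ 0
  bindIdx-self x r with x ≟ x
  ... | yes _ = refl
  ... | no x≢x = ⊥-elim (x≢x refl)

  bindIdx-other : ∀ x r y → y ≢ x → bindIdx x r y ≡ suc (r y)
  bindIdx-other x r y y≢x with y ≟ x
  ... | yes y≡x = ⊥-elim (y≢x y≡x)
  ... | no _ = refl

  bindIdx-cong : ∀ x {r r'} → (∀ y → r y ≡ r' y) → ∀ y → bindIdx x r y ≡ bindIdx x r' y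
  bindIdx-cong x r≗r' y with y ≟ x
  ... | yes _ = refl
  ... | no _ = cong suc (r≗r' y)

  liftR-bindIdx : ∀ ρ x r y → liftR ρ (bindIdx x r y) ≡ bindIdx x (λ z → ρ (r z)) y
  liftR-bindIdx ρ x r y with y ≟ x
  ... | yes _ = refl
  ... | no _ = refl

  idx-bind : ∀ Γ x S y → idx L (Γ , x ∶ S) y ≡ bindIdx x (idx L Γ) y
  idx-bind Γ x S y with y ≟ x
  ... | yes _ = refl
  ... | no _ = refl

  map-var-toList : ∀ {n} (xs : Vec ℕ n) (r : ℕ → ℕ) →
    map (λ x → Tm.var (r x)) (Vec.toList xs) ≡ List.tabulate (λ f → Tm.var (r (lookup xs f)))
  map-var-toList Vec.[] r = refl
  map-var-toList (x Vec.∷ xs) r = cong (Tm.var (r x) ∷_) (map-var-toList xs r)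

  sortTy-cong : ∀ K xs m {r r'} → (∀ f → r (lookup xs f) ≡ r' (lookup xs f)) →
                sortTy (K , xs) m r ≡ sortTy (K , xs) m r'
  sortTy-cong K xs m {r} {r'} r≗r' = cong (λ as → El (appAll (proj nObj K (var m)) as))
    (trans (map-var-toList xs r)
      (trans (tabulate-cong (λ f → cong Tm.var (r≗r' f))) (sym (map-var-toList xs r'))))

  ren-sortTy : ∀ ρ S m r → ren ρ (sortTy S m r) ≡ sortTy S (ρ m) (λ x → ρ (r x))
  ren-sortTy ρ (K , xs) m r = cong El
    (trans (ren-appAll ρ (proj nObj K (var m)) (map (λ x → Tm.var (r x)) (Vec.toList xs)))
           (cong₂ appAll (ren-proj ρ nObj K (var m))
                         (sym (map-∘ {g = ren ρ} {f = λ x → Tm.var (r x)} (Vec.toList xs)))))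

  formTy-cong : ∀ φ m {r r'} → (∀ y → r y ≡ r' y) → formTy φ m r ≡ formTy φ m r'
  formTy-cong ⊥ᶠ m r≗r' = refl
  formTy-cong ⊤ᶠ m r≗r' = refl
  formTy-cong (φ ∧ᶠ ψ) m r≗r' =
    cong₂ Sg (formTy-cong φ m r≗r') (formTy-cong ψ (suc m) (λ y → cong suc (r≗r' y)))
  formTy-cong (φ ∨ᶠ ψ) m r≗r' = cong₂ Sum (formTy-cong φ m r≗r') (formTy-cong ψ m r≗r')
  formTy-cong (φ ⇒ᶠ ψ) m r≗r' =
    cong₂ Pi (formTy-cong φ m r≗r') (formTy-cong ψ (suc m) (λ y → cong suc (r≗r' y)))
  formTy-cong (∀ᶠ x (K , xs) φ) m r≗r' =
    cong₂ Pi (sortTy-cong K xs m (λ f → r≗r' (lookup xs f))) (formTy-cong φ (suc m) (bindIdx-cong x r≗r'))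
  formTy-cong (∃ᶠ x (K , xs) φ) m r≗r' =
    cong₂ Sg (sortTy-cong K xs m (λ f → r≗r' (lookup xs f))) (formTy-cong φ (suc m) (bindIdx-cong x r≗r'))

  ren-formTy : ∀ φ ρ m r → ren ρ (formTy φ m r) ≡ formTy φ (ρ m) (λ y → ρ (r y))
  ren-formTy ⊥ᶠ ρ m r = refl
  ren-formTy ⊤ᶠ ρ m r = refl
  ren-formTy (φ ∧ᶠ ψ) ρ m r = cong₂ Sg (ren-formTy φ ρ m r) (ren-formTy ψ (liftR ρ) (suc m) _)
  ren-formTy (φ ∨ᶠ ψ) ρ m r = cong₂ Sum (ren-formTy φ ρ m r) (ren-formTy ψ ρ m r)
  ren-formTy (φ ⇒ᶠ ψ) ρ m r = cong₂ Pi (ren-formTy φ ρ m r) (ren-formTy ψ (liftR ρ) (suc m) _)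
  ren-formTy (∀ᶠ x S φ) ρ m r = cong₂ Pi (ren-sortTy ρ S m r)
    (trans (ren-formTy φ (liftR ρ) (suc m) (bindIdx x r)) (formTy-cong φ _ (liftR-bindIdx ρ x r)))
  ren-formTy (∃ᶠ x S φ) ρ m r = cong₂ Sg (ren-sortTy ρ S m r)
    (trans (ren-formTy φ (liftR ρ) (suc m) (bindIdx x r)) (formTy-cong φ _ (liftR-bindIdx ρ x r)))

  ⟦⟧F≡formTy : ∀ φ Γ → ⟦_⟧F L φ Γ ≡ formTy φ (len L Γ) (idx L Γ)
  ⟦⟧F≡formTy ⊥ᶠ Γ = refl
  ⟦⟧F≡formTy ⊤ᶠ Γ = refl
  ⟦⟧F≡formTy (φ ∧ᶠ ψ) Γ =
    cong₂ Sg (⟦⟧F≡formTy φ Γ) (trans (cong wk (⟦⟧F≡formTy ψ Γ)) (ren-formTy ψ suc _ _))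
  ⟦⟧F≡formTy (φ ∨ᶠ ψ) Γ = cong₂ Sum (⟦⟧F≡formTy φ Γ) (⟦⟧F≡formTy ψ Γ)
  ⟦⟧F≡formTy (φ ⇒ᶠ ψ) Γ =
    cong₂ Pi (⟦⟧F≡formTy φ Γ) (trans (cong wk (⟦⟧F≡formTy ψ Γ)) (ren-formTy ψ suc _ _))
  ⟦⟧F≡formTy (∀ᶠ x S φ) Γ =
    cong (Pi _) (trans (⟦⟧F≡formTy φ (Γ , x ∶ S)) (formTy-cong φ _ (idx-bind Γ x S)))
  ⟦⟧F≡formTy (∃ᶠ x S φ) Γ =
    cong (Sg _) (trans (⟦⟧F≡formTy φ (Γ , x ∶ S)) (formTy-cong φ _ (idx-bind Γ x S)))

  data Binds : Ctx L → ℕ → Sort L → Set where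
    here  : ∀ {Γ x S} → Binds (Γ , x ∶ S) x S
    there : ∀ {Γ x S y T} → x ≢ y → Binds Γ x S → Binds (Γ , y ∶ T) x S

  Bound : Ctx L → ℕ → Set
  Bound Γ x = Σ (Sort L) (Binds Γ x)

  fresh-¬Binds : ∀ {Γ x S} → _∉_ L x Γ → Binds Γ x S → ⊥
  fresh-¬Binds (x≢y , _) here = x≢y refl
  fresh-¬Binds (_ , fresh) (there _ b) = fresh-¬Binds fresh b

  Bound-≢-fresh : ∀ {Γ x z} → Bound Γ z → _∉_ L x Γ → z ≢ x
  Bound-≢-fresh (_ , b) fresh refl = fresh-¬Binds fresh b

  Bound-wk : ∀ {Γ x S z} → Bound Γ z → _∉_ L x Γ → Bound (Γ , x ∶ S) z
  Bound-wk (T , b) fresh = T , there (Bound-≢-fresh (T , b) fresh) b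

  ok-ext-inv : ∀ {Γ x S} → LDer L (okˡ (Γ , x ∶ S)) → LDer L (sortˡ Γ S) × _∉_ L x Γ
  ok-ext-inv (ok-ext d fresh) = d , fresh

  var-ok : ∀ {Γ x S} → LDer L (varˡ Γ x S) → LDer L (okˡ Γ)
  var-ok (var d) = d

  sort-ok : ∀ {Γ S} → LDer L (sortˡ Γ S) → LDer L (okˡ Γ)
  sort-ok (wk-sort _ dok) = dok
  sort-ok (sort {K = K} ds dok) = zero-or-Fin (nArr K) dok (λ f → var-ok (ds f))

  form-ok : ∀ {Γ φ} → LDer L (formˡ Γ φ) → LDer L (okˡ Γ)
  form-ok (wk-form _ dok) = dok
  form-ok (⊥-form dok) = dok
  form-ok (⊤-form dok) = dok
  form-ok (∧-form d _) = form-ok d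
  form-ok (∨-form d _) = form-ok d
  form-ok (⇒-form d _) = form-ok d
  form-ok (∀-form dok _) = dok
  form-ok (∃-form dok _) = dok

  var-Binds : ∀ {Γ x S} → LDer L (varˡ Γ x S) → Binds Γ x S
  var-Binds (var {Γ} {x} {S} {Δ} d) = go Δ d
    where
    go : ∀ Δ → LDer L (okˡ (_⧺_ L (Γ , x ∶ S) Δ)) → Binds (_⧺_ L (Γ , x ∶ S) Δ) x S
    go ∅ _ = here
    go (Δ , y ∶ T) d with ok-ext-inv d
    ... | dT , fresh = there (λ x≡y → fresh-¬Binds fresh (subst (λ z → Binds _ z S) x≡y b)) b
      where b = go Δ (sort-ok dT)

  sort-args-Bound : ∀ {Γ K xs} → LDer L (sortˡ Γ (K , xs)) → ∀ f → Bound Γ (lookup xs f)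
  sort-args-Bound (wk-sort d dok) f = Bound-wk (sort-args-Bound d f) (proj₂ (ok-ext-inv dok))
  sort-args-Bound (sort ds _) f = _ , var-Binds (ds f)

  ok-args-Bound : ∀ {Γ y K xs} → LDer L (okˡ Γ) → Binds Γ y (K , xs) → ∀ f → Bound Γ (lookup xs f)
  ok-args-Bound (ok-ext d fresh) here f = Bound-wk (sort-args-Bound d f) fresh
  ok-args-Bound (ok-ext d fresh) (there _ b) f = Bound-wk (ok-args-Bound (sort-ok d) b f) fresh

  -- σ is vacuous since Struc(L) is closed; carrying it spares a proof of closedness.
  StrucVar : MCtx → ℕ → Set
  StrucVar Δ m = MDer (okᴹ Δ) × Σ (ℕ → Tm) (λ σ → MDer (termᴹ Δ (var m) (sub σ (Struc L))))

  Realises : Ctx L → MCtx → ℕ → (ℕ → ℕ) → Set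
  Realises Γ Δ m r = ∀ y T → Binds Γ y T → MDer (termᴹ Δ (var (r y)) (sortTy T m r))

  StrucVar-wk : ∀ {Δ m B} → StrucVar Δ m → MDer (typeᴹ Δ B) → StrucVar (B ∷ Δ) (suc m)
  StrucVar-wk {Δ} {m} {B} (_ , σ , dM) dB = ctx-cons dB , (λ x → wk (σ x)) ,
    subst (λ T → MDer (termᴹ (B ∷ Δ) (var (suc m)) T)) (wk-sub σ (Struc L)) (var-suc dM dB)

  Realises-wk : ∀ {Γ Δ m r B} → Realises Γ Δ m r → MDer (typeᴹ Δ B) →
                Realises Γ (B ∷ Δ) (suc m) (λ y → suc (r y))
  Realises-wk {Δ = Δ} {m} {r} {B} R dB y T b =
    subst (λ A → MDer (termᴹ (B ∷ Δ) (var (suc (r y))) A)) (ren-sortTy suc T m r) (var-suc (R y T b) dB)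

  Realises-strengthen : ∀ {Γ x S Δ m r} → Realises (Γ , x ∶ S) Δ m r → _∉_ L x Γ → Realises Γ Δ m r
  Realises-strengthen R fresh y T b =
    R y T (there (λ y≡x → fresh-¬Binds fresh (subst (λ z → Binds _ z T) y≡x b)) b)

  Realises-cong : ∀ {Γ Δ m r r'} → (∀ y → r y ≡ r' y) → Realises Γ Δ m r → Realises Γ Δ m r'
  Realises-cong {Δ = Δ} {m} r≗r' R y (K , xs) b =
    subst₂ (λ i A → MDer (termᴹ Δ (var i) A)) (r≗r' y) (sortTy-cong K xs m (λ f → r≗r' (lookup xs f)))
           (R y (K , xs) b)

  wk-sortTy-bind : ∀ {Γ x} m r K xs → _∉_ L x Γ → (∀ f → Bound Γ (lookup xs f)) →
                   wk (sortTy (K , xs) m r) ≡ sortTy (K , xs) (suc m) (bindIdx x r)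
  wk-sortTy-bind {x = x} m r K xs fresh bound = trans (ren-sortTy suc (K , xs) m r)
    (sortTy-cong K xs (suc m) (λ f → sym (bindIdx-other x r _ (Bound-≢-fresh (bound f) fresh))))

  Realises-bind : ∀ {Γ Δ m r x K xs} → LDer L (okˡ Γ) → _∉_ L x Γ → (∀ f → Bound Γ (lookup xs f)) →
    Realises Γ Δ m r → MDer (typeᴹ Δ (sortTy (K , xs) m r)) →
    Realises (Γ , x ∶ (K , xs)) (sortTy (K , xs) m r ∷ Δ) (suc m) (bindIdx x r)
  Realises-bind {Δ = Δ} {m} {r} {x} {K} {xs} _ fresh bound R dS .x .(K , xs) here =
    subst₂ (λ i A → MDer (termᴹ (sortTy (K , xs) m r ∷ Δ) (var i) A))
           (sym (bindIdx-self x r)) (wk-sortTy-bind m r K xs fresh bound) (var-zero dS)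
  Realises-bind {Δ = Δ} {m} {r} {x} {K} {xs} ok fresh _ R dS y (K' , ys) (there y≢x b) =
    subst₂ (λ i A → MDer (termᴹ (sortTy (K , xs) m r ∷ Δ) (var i) A))
           (sym (bindIdx-other x r y y≢x)) (wk-sortTy-bind m r K' ys fresh (ok-args-Bound ok b))
           (var-suc (R y (K' , ys) b) dS)

  sort-type : ∀ {Γ S} → LDer L (sortˡ Γ S) → ∀ {Δ m r} → StrucVar Δ m → Realises Γ Δ m r →
              MDer (typeᴹ Δ (sortTy S m r))
  sort-type (wk-sort d dok) M R = sort-type d M (Realises-strengthen R (proj₂ (ok-ext-inv dok)))
  sort-type (sort {K = K} {xs} ds _) {Δ} {m} {r} (ok , σ , dM) R =
    El-form (subst (λ as → MDer (termᴹ Δ (appAll (proj nObj K (var m)) as) U)) (sym (map-var-toList xs r))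
                   (appAll-component-U σ (var m) ok dM K (λ f → var (r (lookup xs f))) arg-typed))
    where
    arg-typed : ∀ f → MDer (termᴹ Δ (var (r (lookup xs f)))
      (El (appAll (proj nObj (cod K f) (var m)) (List.tabulate (λ p → Tm.var (r (lookup xs (comp K f p))))))))
    arg-typed f =
      subst (λ as → MDer (termᴹ Δ (var (r (lookup xs f))) (El (appAll (proj nObj (cod K f) (var m)) as))))
            (trans (map-var-toList (Vec.tabulate (λ p → lookup xs (comp K f p))) r)
                   (tabulate-cong (λ p → cong (λ z → Tm.var (r z)) (lookup∘tabulate _ p))))
            (R (lookup xs f) (subSort L K xs f) (var-Binds (ds f)))

  formula-type : ∀ {Γ φ} → LDer L (formˡ Γ φ) → ∀ {Δ m r} → StrucVar Δ m → Realises Γ Δ m r →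
                 MDer (typeᴹ Δ (formTy φ m r))
  formula-type (wk-form d dok) M R = formula-type d M (Realises-strengthen R (proj₂ (ok-ext-inv dok)))
  formula-type (⊥-form _) M R = Zero-form (proj₁ M)
  formula-type (⊤-form _) M R = One-form (proj₁ M)
  formula-type (∧-form d e) M R = Sg-form dφ (formula-type e (StrucVar-wk M dφ) (Realises-wk R dφ))
    where dφ = formula-type d M R
  formula-type (∨-form d e) M R = Sum-form (formula-type d M R) (formula-type e M R)
  formula-type (⇒-form d e) M R = Pi-form dφ (formula-type e (StrucVar-wk M dφ) (Realises-wk R dφ))
    where dφ = formula-type d M R
  formula-type (∀-form dok d) M R with ok-ext-inv (form-ok d)
  ... | dS , fresh = Pi-form tS (formula-type d (StrucVar-wk M tS) (Realises-bind dok fresh (sort-args-Bound dS) R tS))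
    where tS = sort-type dS M R
  formula-type (∃-form dok d) M R with ok-ext-inv (form-ok d)
  ... | dS , fresh = Sg-form tS (formula-type d (StrucVar-wk M tS) (Realises-bind dok fresh (sort-args-Bound dS) R tS))
    where tS = sort-type dS M R

  canonical : ∀ {Γ} → LDer L (okˡ Γ) →
              StrucVar (⟦_⟧C L Γ) (len L Γ) × Realises Γ (⟦_⟧C L Γ) (len L Γ) (idx L Γ)
  canonical ok-∅ = (ctx-cons Struc-type , (λ x → var (suc x)) , Struc-var) , λ _ _ ()
    where
    Struc-var : MDer (termᴹ (Struc L ∷ []) (var 0) (sub (λ x → var (suc x)) (Struc L)))
    Struc-var = subst (λ T → MDer (termᴹ (Struc L ∷ []) (var 0) T))
                      (trans (cong wk (sym (sub-var (Struc L)))) (wk-sub var (Struc L))) (var-zero Struc-type)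
  canonical (ok-ext {Γ} {S} {x} d fresh) with canonical (sort-ok d)
  ... | M , R = StrucVar-wk M dS ,
                Realises-cong (λ y → sym (idx-bind Γ x S y))
                              (Realises-bind (sort-ok d) fresh (sort-args-Bound d) R dS)
    where dS = sort-type d M R

theorem2p15 : (L : FOLDS) (J : LJudgment L) → LDer L J → MDer (⟦_⟧J L J)
theorem2p15 L (okˡ Γ) d = proj₁ (proj₁ (canonical L d))
theorem2p15 L (sortˡ Γ S) d with canonical L (sort-ok L d)
... | M , R = sort-type L d M R
theorem2p15 L (varˡ Γ x S) d = proj₂ (canonical L (var-ok L d)) x S (var-Binds L d)
theorem2p15 L (formˡ Γ φ) d with canonical L (form-ok L d)
... | M , R = subst (λ T → MDer (typeᴹ (⟦_⟧C L Γ) T)) (sym (⟦⟧F≡formTy L φ Γ)) (formula-type L d M R)
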